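{- Let $R$ be a ring and consider $x\in R[x]$. (a) If $R$ is reduced then $\operatorname{lpow}(x)\subseteq\operatorname{pow}(x)$. (b) If $R$ is reduced and indecomposable then $\operatorname{pow}(x)=\operatorname{lpow}(x)$.
   Context: All rings are nonzero, commutative and unital. For an element $p$ of a ring $S$, $\operatorname{pow}(p)=\{p^{n}:n\geq 1\}$, and $\operatorname{lpow}(p)$ (the logical powers of $p$) is the set of $f\in S$ such that: $p$ divides $f$; $p-1$ divides $f-1$; and every divisor of $f$ is either a unit or a multiple of $p$. Reduced: no nonzero nilpotents; indecomposable: only idempotents are $0,1$. -}

module Defs where

open import Level using (_⊔_)
open import Algebra.Bundles using (CommutativeRing)
open import Data.Nat using (ℕ; zero; suc; _≥_)
open import Data.List using (List; []; _∷_; map)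
open import Data.Product using (Σ; _×_; ∃; ∃-syntax)
open import Data.Sum using (_⊎_)
open import Relation.Nullary using (¬_)

-- Polynomial ring R[x] over a commutative ring R, with coefficient lists
-- (constant term first).  Two polynomials are equal iff all their
-- coefficients agree (so trailing zeros are irrelevant).
module Poly {c ℓ} (R : CommutativeRing c ℓ) where
  open CommutativeRing R renaming (Carrier to A)

  _^ᴿ_ : A → ℕ → A
  a ^ᴿ zero = 1#
  a ^ᴿ suc n = a * (a ^ᴿ n)

  NonzeroRing : Set ℓ
  NonzeroRing = ¬ (1# ≈ 0#)

  Reduced : Set (c ⊔ ℓ)
  Reduced = ∀ (a : A) (n : ℕ) → a ^ᴿ n ≈ 0# → a ≈ 0#

  Indecomposable : Set (c ⊔ ℓ)
  Indecomposable = ∀ (e : A) → e * e ≈ e → (e ≈ 0#) ⊎ (e ≈ 1#)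

  Pol : Set c
  Pol = List A

  coeff : Pol → ℕ → A
  coeff [] n = 0#
  coeff (a ∷ p) zero = a
  coeff (a ∷ p) (suc n) = coeff p n

  infix 4 _≈ₚ_
  _≈ₚ_ : Pol → Pol → Set ℓ
  p ≈ₚ q = ∀ n → coeff p n ≈ coeff q n

  infixl 6 _+ₚ_ _-ₚ_
  infixl 7 _*ₚ_

  _+ₚ_ : Pol → Pol → Pol
  [] +ₚ q = q
  (a ∷ p) +ₚ [] = a ∷ p
  (a ∷ p) +ₚ (b ∷ q) = (a + b) ∷ (p +ₚ q)

  -ₚ_ : Pol → Pol
  -ₚ p = map -_ p

  _-ₚ_ : Pol → Pol → Pol
  p -ₚ q = p +ₚ (-ₚ q)

  _*ₚ_ : Pol → Pol → Pol
  [] *ₚ q = []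
  (a ∷ p) *ₚ q = map (a *_) q +ₚ (0# ∷ (p *ₚ q))

  1ₚ : Pol
  1ₚ = 1# ∷ []

  X : Pol
  X = 0# ∷ 1# ∷ []

  _^ₚ_ : Pol → ℕ → Pol
  p ^ₚ zero = 1ₚ
  p ^ₚ suc n = p *ₚ (p ^ₚ n)

  infix 4 _∣ₚ_
  _∣ₚ_ : Pol → Pol → Set (c ⊔ ℓ)
  p ∣ₚ f = ∃[ q ] (q *ₚ p ≈ₚ f)

  IsUnit : Pol → Set (c ⊔ ℓ)
  IsUnit u = u ∣ₚ 1ₚ

  pow : Pol → Pol → Set ℓ
  pow p f = ∃[ n ] (n ≥ 1 × f ≈ₚ p ^ₚ n)

  lpow : Pol → Pol → Set (c ⊔ ℓ)
  lpow p f =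
    (p ∣ₚ f) ×
    ((p -ₚ 1ₚ) ∣ₚ (f -ₚ 1ₚ)) ×
    (∀ (d : Pol) → d ∣ₚ f → IsUnit d ⊎ (p ∣ₚ d))

module Submission where

open import Defs
open import Algebra.Bundles using (CommutativeRing)
open import Data.Product using (_×_)

open import Data.Nat as N using (ℕ; zero; suc; z≤n; s≤s)
import Data.Nat.Properties as NP
open import Data.List using ([]; _∷_; map; length; replicate; drop)
open import Data.Product using (Σ; _,_)
open import Data.Sum using (_⊎_; inj₁; inj₂)
open import Data.Empty using (⊥-elim)
open import Relation.Nullary using (yes; no)
import Relation.Binary.PropositionalEquality as P
import Algebra.Properties.CommutativeSemigroup

-- (a) If f ∈ lpow(x), write f = x·g and keep splitting off x while the
--     cofactor g (a divisor of f) is not a unit.  Either f runs out of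
--     coefficients, impossible since x-1 ∣ f-1 forces f(1) = 1 ≠ 0, or
--     f = xᵏ·u with u a unit.  Over a reduced ring units of R[x] are
--     constant (the leading coefficient of a nonconstant unit is nilpotent),
--     and u(1) = f(1) = 1 gives u = 1, i.e. f = xᵏ.
-- (b) For f = xᵐ⁺¹, x ∣ f and x-1 ∣ f-1 via the geometric sum.  If q·d = xᵐ⁺¹
--     then d₀ = d(0) annihilates q₀,…,q_m (reducedness), so e = d₀·q_{m+1} is
--     idempotent with d₀ = e·d₀; e = 0 gives x ∣ d, and e = 1 gives
--     q = xᵐ⁺¹·q', whence q'·d = 1.
module XPowers {c ℓ} (R : CommutativeRing c ℓ) where
  open CommutativeRing R renaming (Carrier to A)
  open Poly R
  open import Relation.Binary.Reasoning.Setoid setoid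
  open import Algebra.Properties.AbelianGroup +-abelianGroup using (x∙y⁻¹≈ε⇒x≈y)
  module +-Props = Algebra.Properties.CommutativeSemigroup +-commutativeSemigroup
  module *-Props = Algebra.Properties.CommutativeSemigroup *-commutativeSemigroup

  tl : Pol → Pol
  tl [] = []
  tl (_ ∷ p) = p

  coeff-tl : ∀ p i → coeff (tl p) i ≈ coeff p (suc i)
  coeff-tl [] i = refl
  coeff-tl (a ∷ p) i = refl

  coeff-beyond : ∀ p t → length p N.≤ t → coeff p t ≈ 0#
  coeff-beyond [] t _ = refl
  coeff-beyond (a ∷ p) (suc t) (s≤s h) = coeff-beyond p t h

  coeff-+ : ∀ p q t → coeff (p +ₚ q) t ≈ coeff p t + coeff q t
  coeff-+ [] q t = sym (+-identityˡ _)
  coeff-+ (a ∷ p) [] t = sym (+-identityʳ _)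
  coeff-+ (a ∷ p) (b ∷ q) zero = refl
  coeff-+ (a ∷ p) (b ∷ q) (suc t) = coeff-+ p q t

  coeff-scale : ∀ a p t → coeff (map (a *_) p) t ≈ a * coeff p t
  coeff-scale a [] t = sym (zeroʳ a)
  coeff-scale a (b ∷ p) zero = refl
  coeff-scale a (b ∷ p) (suc t) = coeff-scale a p t

  coeff-*-zero : ∀ p q → coeff (p *ₚ q) 0 ≈ coeff p 0 * coeff q 0
  coeff-*-zero [] q = sym (zeroˡ _)
  coeff-*-zero (a ∷ p) q = trans (coeff-+ (map (a *_) q) (0# ∷ (p *ₚ q)) 0)
                                 (trans (+-cong (coeff-scale a q 0) refl) (+-identityʳ _))

  coeff-*-suc : ∀ p q s → coeff (p *ₚ q) (suc s) ≈ coeff p 0 * coeff q (suc s) + coeff (tl p *ₚ q) s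
  coeff-*-suc [] q s = sym (trans (+-identityʳ _) (zeroˡ _))
  coeff-*-suc (a ∷ p) q s = trans (coeff-+ (map (a *_) q) (0# ∷ (p *ₚ q)) (suc s))
                                  (+-cong (coeff-scale a q (suc s)) refl)

  coeff-*-sucʳ : ∀ q d s → coeff (q *ₚ d) (suc s) ≈ coeff q (suc s) * coeff d 0 + coeff (q *ₚ tl d) s
  coeff-*-sucʳ q d zero = begin
    coeff (q *ₚ d) 1                                        ≈⟨ coeff-*-suc q d 0 ⟩
    coeff q 0 * coeff d 1 + coeff (tl q *ₚ d) 0             ≈⟨ +-cong (*-cong refl (sym (coeff-tl d 0))) (coeff-*-zero (tl q) d) ⟩
    coeff q 0 * coeff (tl d) 0 + coeff (tl q) 0 * coeff d 0 ≈⟨ +-comm _ _ ⟩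
    coeff (tl q) 0 * coeff d 0 + coeff q 0 * coeff (tl d) 0 ≈⟨ +-cong (*-cong (coeff-tl q 0) refl) (sym (coeff-*-zero q (tl d))) ⟩
    coeff q 1 * coeff d 0 + coeff (q *ₚ tl d) 0             ∎
  coeff-*-sucʳ q d (suc s) = begin
    coeff (q *ₚ d) (suc (suc s))
      ≈⟨ coeff-*-suc q d (suc s) ⟩
    coeff q 0 * coeff d (suc (suc s)) + coeff (tl q *ₚ d) (suc s)
      ≈⟨ +-cong (*-cong refl (sym (coeff-tl d (suc s)))) (coeff-*-sucʳ (tl q) d s) ⟩
    coeff q 0 * coeff (tl d) (suc s) + (coeff (tl q) (suc s) * coeff d 0 + coeff (tl q *ₚ tl d) s)
      ≈⟨ +-Props.x∙yz≈y∙xz _ _ _ ⟩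
    coeff (tl q) (suc s) * coeff d 0 + (coeff q 0 * coeff (tl d) (suc s) + coeff (tl q *ₚ tl d) s)
      ≈⟨ +-cong (*-cong (coeff-tl q (suc s)) refl) (sym (coeff-*-suc q (tl d) s)) ⟩
    coeff q (suc (suc s)) * coeff d 0 + coeff (q *ₚ tl d) (suc s)
      ∎

  coeff-1ₚ-* : ∀ p s → coeff (1ₚ *ₚ p) s ≈ coeff p s
  coeff-1ₚ-* p zero = trans (coeff-*-zero 1ₚ p) (*-identityˡ _)
  coeff-1ₚ-* p (suc s) = trans (coeff-*-suc 1ₚ p s) (trans (+-cong (*-identityˡ _) refl) (+-identityʳ _))

  coeff-*-1ₚ : ∀ p s → coeff (p *ₚ 1ₚ) s ≈ coeff p s
  coeff-*-1ₚ p zero = trans (coeff-*-zero p 1ₚ) (*-identityʳ _)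
  coeff-*-1ₚ p (suc s) = begin
    coeff (p *ₚ 1ₚ) (suc s)                  ≈⟨ coeff-*-suc p 1ₚ s ⟩
    coeff p 0 * 0# + coeff (tl p *ₚ 1ₚ) s    ≈⟨ +-cong (zeroʳ _) (coeff-*-1ₚ (tl p) s) ⟩
    0# + coeff (tl p) s                      ≈⟨ trans (+-identityˡ _) (coeff-tl p s) ⟩
    coeff p (suc s)                          ∎

  coeff-scale-* : ∀ a p r t → coeff (map (a *_) p *ₚ r) t ≈ a * coeff (p *ₚ r) t
  coeff-scale-* a [] r t = sym (zeroʳ a)
  coeff-scale-* a (b ∷ p) r zero = begin
    coeff (map (a *_) (b ∷ p) *ₚ r) 0 ≈⟨ coeff-*-zero (map (a *_) (b ∷ p)) r ⟩
    (a * b) * coeff r 0               ≈⟨ *-assoc _ _ _ ⟩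
    a * (b * coeff r 0)               ≈⟨ *-cong refl (sym (coeff-*-zero (b ∷ p) r)) ⟩
    a * coeff ((b ∷ p) *ₚ r) 0        ∎
  coeff-scale-* a (b ∷ p) r (suc s) = begin
    coeff (map (a *_) (b ∷ p) *ₚ r) (suc s)           ≈⟨ coeff-*-suc (map (a *_) (b ∷ p)) r s ⟩
    (a * b) * coeff r (suc s) + coeff (map (a *_) p *ₚ r) s ≈⟨ +-cong (*-assoc _ _ _) (coeff-scale-* a p r s) ⟩
    a * (b * coeff r (suc s)) + a * coeff (p *ₚ r) s  ≈⟨ sym (distribˡ _ _ _) ⟩
    a * (b * coeff r (suc s) + coeff (p *ₚ r) s)      ≈⟨ *-cong refl (sym (coeff-*-suc (b ∷ p) r s)) ⟩
    a * coeff ((b ∷ p) *ₚ r) (suc s)                  ∎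

  coeff-*-low : ∀ p r s → (∀ i → i N.≤ s → coeff p i ≈ 0#) → coeff (p *ₚ r) s ≈ 0#
  coeff-*-low p r zero h = trans (coeff-*-zero p r) (trans (*-cong (h 0 z≤n) refl) (zeroˡ _))
  coeff-*-low p r (suc s) h = trans (coeff-*-suc p r s)
    (trans (+-cong (trans (*-cong (h 0 z≤n) refl) (zeroˡ _))
                   (coeff-*-low (tl p) r s (λ i i≤s → trans (coeff-tl p i) (h (suc i) (s≤s i≤s)))))
           (+-identityʳ _))

  Deg : Pol → ℕ → Set ℓ
  Deg p n = ∀ i → n N.< i → coeff p i ≈ 0#

  coeff-*-top : ∀ p q n m → Deg p n → Deg q m → coeff (p *ₚ q) (n N.+ m) ≈ coeff p n * coeff q m
  coeff-*-top p q zero zero _ _ = coeff-*-zero p q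
  coeff-*-top p q zero (suc m) dp dq = trans (coeff-*-suc p q m)
    (trans (+-cong refl (coeff-*-low (tl p) q m (λ i _ → trans (coeff-tl p i) (dp (suc i) (s≤s z≤n)))))
           (+-identityʳ _))
  coeff-*-top p q (suc n) m dp dq = begin
    coeff (p *ₚ q) (suc (n N.+ m))
      ≈⟨ coeff-*-suc p q (n N.+ m) ⟩
    coeff p 0 * coeff q (suc (n N.+ m)) + coeff (tl p *ₚ q) (n N.+ m)
      ≈⟨ +-cong (trans (*-cong refl (dq _ (s≤s (NP.m≤n+m m n)))) (zeroʳ _))
                (coeff-*-top (tl p) q n m (λ i n<i → trans (coeff-tl p i) (dp (suc i) (s≤s n<i))) dq) ⟩
    0# + coeff (tl p) n * coeff q m
      ≈⟨ trans (+-identityˡ _) (*-cong (coeff-tl p n) refl) ⟩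
    coeff p (suc n) * coeff q m
      ∎

  -- 'Shift k g f' says f = xᵏ·g, read off on coefficients
  record Shift (k : ℕ) (g f : Pol) : Set ℓ where
    constructor shift
    field
      low  : ∀ i → i N.< k → coeff f i ≈ 0#
      high : ∀ j → coeff f (k N.+ j) ≈ coeff g j
  open Shift

  shift-unique : ∀ {k g g′ f f′} → Shift k g f → Shift k g′ f′ → g ≈ₚ g′ → f ≈ₚ f′
  shift-unique {k} sh sh′ g≈g′ t with t N.<? k
  ... | yes t<k = trans (low sh t t<k) (sym (low sh′ t t<k))
  ... | no t≮k with NP.m≤n⇒∃[o]m+o≡n (NP.≮⇒≥ t≮k)
  ...   | j , P.refl = trans (high sh j) (trans (g≈g′ j) (sym (high sh′ j)))

  shift-cancel : ∀ {k g g′ f f′} → Shift k g f → Shift k g′ f′ → f ≈ₚ f′ → g ≈ₚ g′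
  shift-cancel {k} sh sh′ f≈f′ j = trans (sym (high sh j)) (trans (f≈f′ (k N.+ j)) (high sh′ j))

  shift-resp : ∀ {k g g′ f} → g ≈ₚ g′ → Shift k g f → Shift k g′ f
  shift-resp g≈g′ (shift lo hi) = shift lo (λ j → trans (hi j) (g≈g′ j))

  shift-head : ∀ {k g f} → Shift k g f → coeff f k ≈ coeff g 0
  shift-head {k} {g} {f} sh = P.subst (λ t → coeff f t ≈ coeff g 0) (NP.+-identityʳ k) (high sh 0)

  shift-trans : ∀ {k m g p f} → Shift k p f → Shift m g p → Shift (k N.+ m) g f
  shift-trans {k} {m} {g} {p} {f} (shift lo hi) (shift lo′ hi′) = shift lo″ hi″
    where
    lo″ : ∀ i → i N.< k N.+ m → coeff f i ≈ 0#
    lo″ i i<k+m with i N.<? k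
    ... | yes i<k = lo i i<k
    ... | no i≮k with NP.m≤n⇒∃[o]m+o≡n (NP.≮⇒≥ i≮k)
    ...   | j , P.refl = trans (hi j) (lo′ j (NP.+-cancelˡ-< k j m i<k+m))
    hi″ : ∀ j → coeff f (k N.+ m N.+ j) ≈ coeff g j
    hi″ j = P.subst (λ t → coeff f t ≈ coeff g j) (P.sym (NP.+-assoc k m j))
                    (trans (hi (m N.+ j)) (hi′ j))

  shift-∷-* : ∀ {a} → a ≈ 0# → ∀ p g → Shift 1 (p *ₚ g) ((a ∷ p) *ₚ g)
  shift-∷-* {a} a≈0 p g = shift lo hi
    where
    a*-≈0 : ∀ b → a * b ≈ 0#
    a*-≈0 b = trans (*-cong a≈0 refl) (zeroˡ b)
    lo : ∀ i → i N.< 1 → coeff ((a ∷ p) *ₚ g) i ≈ 0#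
    lo zero _ = trans (coeff-*-zero (a ∷ p) g) (a*-≈0 _)
    lo (suc i) (s≤s ())
    hi : ∀ j → coeff ((a ∷ p) *ₚ g) (suc j) ≈ coeff (p *ₚ g) j
    hi j = trans (coeff-*-suc (a ∷ p) g j) (trans (+-cong (a*-≈0 _) refl) (+-identityˡ _))

  X*-shift : ∀ p → Shift 1 p (X *ₚ p)
  X*-shift p = shift-resp (coeff-1ₚ-* p) (shift-∷-* refl 1ₚ p)

  *X-shift : ∀ p → Shift 1 p (p *ₚ X)
  *X-shift p = shift (λ { zero _ → trans (coeff-*-zero p X) (zeroʳ _) ; (suc i) (s≤s ()) }) hi
    where
    hi : ∀ j → coeff (p *ₚ X) (suc j) ≈ coeff p j
    hi j = trans (coeff-*-sucʳ p X j) (trans (+-cong (zeroʳ _) (coeff-*-1ₚ p j)) (+-identityˡ _))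

  shift-X^ : ∀ k → Shift k 1ₚ (X ^ₚ k)
  shift-X^ zero = shift (λ _ ()) (λ _ → refl)
  shift-X^ (suc k) = shift-trans (X*-shift (X ^ₚ k)) (shift-X^ k)

  shift-tail : ∀ p → coeff p 0 ≈ 0# → Shift 1 (tl p) p
  shift-tail p p₀≈0 = shift (λ { zero _ → p₀≈0 ; (suc i) (s≤s ()) }) (λ j → sym (coeff-tl p j))

  X∣⇒const≈0 : ∀ p → X ∣ₚ p → coeff p 0 ≈ 0#
  X∣⇒const≈0 p (h , hX≈p) = trans (sym (hX≈p 0)) (low (*X-shift h) 0 (s≤s z≤n))

  const≈0⇒X∣ : ∀ p → coeff p 0 ≈ 0# → X ∣ₚ p
  const≈0⇒X∣ p p₀≈0 = tl p , shift-unique (*X-shift (tl p)) (shift-tail p p₀≈0) (λ _ → refl)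

  monomial : ℕ → Pol
  monomial zero = 1ₚ
  monomial (suc k) = 0# ∷ monomial k

  shift-monomial : ∀ k g → Shift k g (monomial k *ₚ g)
  shift-monomial zero g = shift (λ _ ()) (coeff-1ₚ-* g)
  shift-monomial (suc k) g = shift-trans (shift-∷-* refl (monomial k) g) (shift-monomial k g)

  shift⇒∣ : ∀ {k g f} → Shift k g f → g ∣ₚ f
  shift⇒∣ {k} {g} sh = monomial k , shift-unique (shift-monomial k g) sh (λ _ → refl)

  shift-drop-* : ∀ n q d → (∀ i → i N.< n → coeff q i ≈ 0#) → Shift n (drop n q *ₚ d) (q *ₚ d)
  shift-drop-* zero q d _ = shift (λ _ ()) (λ _ → refl)
  shift-drop-* (suc n) [] d _ = shift (λ _ _ → refl) (λ _ → refl)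
  shift-drop-* (suc n) (a ∷ q) d q-low =
    shift-trans (shift-∷-* (q-low 0 (s≤s z≤n)) q d)
                (shift-drop-* n q d (λ i i<n → q-low (suc i) (s≤s i<n)))

  ev : Pol → A
  ev [] = 0#
  ev (a ∷ p) = a + ev p

  ev-zero : ∀ p → p ≈ₚ [] → ev p ≈ 0#
  ev-zero [] _ = refl
  ev-zero (a ∷ p) p≈0 = trans (+-cong (p≈0 0) (ev-zero p (λ i → p≈0 (suc i)))) (+-identityʳ _)

  ev-cong : ∀ p q → p ≈ₚ q → ev p ≈ ev q
  ev-cong [] q p≈q = sym (ev-zero q (λ i → sym (p≈q i)))
  ev-cong (a ∷ p) [] p≈q = ev-zero (a ∷ p) p≈q
  ev-cong (a ∷ p) (b ∷ q) p≈q = +-cong (p≈q 0) (ev-cong p q (λ i → p≈q (suc i)))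

  ev-+ : ∀ p q → ev (p +ₚ q) ≈ ev p + ev q
  ev-+ [] q = sym (+-identityˡ _)
  ev-+ (a ∷ p) [] = sym (+-identityʳ _)
  ev-+ (a ∷ p) (b ∷ q) = trans (+-cong refl (ev-+ p q)) (+-Props.interchange _ _ _ _)

  ev-scale : ∀ a p → ev (map (a *_) p) ≈ a * ev p
  ev-scale a [] = sym (zeroʳ a)
  ev-scale a (b ∷ p) = trans (+-cong refl (ev-scale a p)) (sym (distribˡ _ _ _))

  ev-* : ∀ p q → ev (p *ₚ q) ≈ ev p * ev q
  ev-* [] q = sym (zeroˡ _)
  ev-* (a ∷ p) q = begin
    ev (map (a *_) q +ₚ (0# ∷ (p *ₚ q)))   ≈⟨ ev-+ (map (a *_) q) (0# ∷ (p *ₚ q)) ⟩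
    ev (map (a *_) q) + (0# + ev (p *ₚ q)) ≈⟨ +-cong (ev-scale a q) (trans (+-identityˡ _) (ev-* p q)) ⟩
    a * ev q + ev p * ev q                 ≈⟨ sym (distribʳ _ _ _) ⟩
    (a + ev p) * ev q                      ∎

  ev-monomial : ∀ k → ev (monomial k) ≈ 1#
  ev-monomial zero = +-identityʳ _
  ev-monomial (suc k) = trans (+-identityˡ _) (ev-monomial k)

  ev-shift : ∀ {k g f} → Shift k g f → ev f ≈ ev g
  ev-shift {k} {g} {f} sh = begin
    ev f                   ≈⟨ ev-cong f (monomial k *ₚ g) (shift-unique sh (shift-monomial k g) (λ _ → refl)) ⟩
    ev (monomial k *ₚ g)   ≈⟨ ev-* (monomial k) g ⟩
    ev (monomial k) * ev g ≈⟨ trans (*-cong (ev-monomial k) refl) (*-identityˡ _) ⟩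
    ev g                   ∎

  ev-constant : ∀ p → Deg p 0 → ev p ≈ coeff p 0
  ev-constant [] _ = refl
  ev-constant (a ∷ p) deg = trans (+-cong refl (ev-zero p (λ i → deg (suc i) (s≤s z≤n)))) (+-identityʳ _)

  ev≈1 : ∀ f → (X -ₚ 1ₚ) ∣ₚ (f -ₚ 1ₚ) → ev f ≈ 1#
  ev≈1 f (q , q[X-1]≈f-1) = x∙y⁻¹≈ε⇒x≈y (ev f) 1# (begin
    ev f + - 1#                ≈⟨ sym (ev-minus-1 f) ⟩
    ev (f -ₚ 1ₚ)               ≈⟨ sym (ev-cong (q *ₚ (X -ₚ 1ₚ)) (f -ₚ 1ₚ) q[X-1]≈f-1) ⟩
    ev (q *ₚ (X -ₚ 1ₚ))        ≈⟨ ev-* q (X -ₚ 1ₚ) ⟩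
    ev q * ev (X -ₚ 1ₚ)        ≈⟨ *-cong refl (trans (ev-minus-1 X) (+-cong evX≈1 refl)) ⟩
    ev q * (1# + - 1#)         ≈⟨ *-cong refl (-‿inverseʳ 1#) ⟩
    ev q * 0#                  ≈⟨ zeroʳ _ ⟩
    0#                         ∎)
    where
    ev-minus-1 : ∀ p → ev (p -ₚ 1ₚ) ≈ ev p + - 1#
    ev-minus-1 p = trans (ev-+ p (-ₚ 1ₚ)) (+-cong refl (+-identityʳ _))
    evX≈1 : ev X ≈ 1#
    evX≈1 = trans (+-identityˡ _) (+-identityʳ _)

  -- The leading coefficient a of a unit g of positive degree is nilpotent:
  -- by downward induction on i, aᵏ·wᵢ = 0 as soon as i + k exceeds length w,
  -- where w·g = 1.  The case k = 1 + length w, i = 0 gives a^(1+length w) = 0.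
  leading-coefficient-nilpotent : ∀ w g n → w *ₚ g ≈ₚ 1ₚ → Deg g (suc n) →
                                  coeff g (suc n) ^ᴿ suc (length w) ≈ 0#
  leading-coefficient-nilpotent w g n wg≈1 deg-g = begin
    a ^ᴿ suc M                                    ≈⟨ sym (*-identityʳ _) ⟩
    a ^ᴿ suc M * 1#                               ≈⟨ *-cong refl (sym (wg≈1 0)) ⟩
    a ^ᴿ suc M * coeff (w *ₚ g) 0                 ≈⟨ sym (coeff-scale-* _ w g 0) ⟩
    coeff (map (a ^ᴿ suc M *_) w *ₚ g) 0          ≈⟨ coeff-*-zero (map (a ^ᴿ suc M *_) w) g ⟩
    coeff (map (a ^ᴿ suc M *_) w) 0 * coeff g 0   ≈⟨ *-cong (trans (coeff-scale _ w 0) (annihilates (suc M) 0 (NP.n<1+n M))) refl ⟩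
    0# * coeff g 0                                ≈⟨ zeroˡ _ ⟩
    0#                                            ∎
    where
    a = coeff g (suc n)
    M = length w
    -- if aᵏ·w has degree at most i, then aᵏ⁺¹·wᵢ = 0: it is the top
    -- coefficient of aᵏ·w·g, whose coefficients above degree 0 vanish
    step : ∀ k i → (∀ j → i N.< j → a ^ᴿ k * coeff w j ≈ 0#) → a ^ᴿ suc k * coeff w i ≈ 0#
    step k i above = begin
      (a * a ^ᴿ k) * coeff w i                    ≈⟨ *-Props.xy∙z≈yz∙x _ _ _ ⟩
      (a ^ᴿ k * coeff w i) * a                    ≈⟨ *-cong (sym (coeff-scale _ w i)) refl ⟩
      coeff aᵏw i * coeff g (suc n)               ≈⟨ sym (coeff-*-top aᵏw g i (suc n) deg-aᵏw deg-g) ⟩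
      coeff (aᵏw *ₚ g) (i N.+ suc n)              ≈⟨ coeff-scale-* _ w g (i N.+ suc n) ⟩
      a ^ᴿ k * coeff (w *ₚ g) (i N.+ suc n)       ≈⟨ *-cong refl (trans (wg≈1 _) 1ₚ-vanishes) ⟩
      a ^ᴿ k * 0#                                 ≈⟨ zeroʳ _ ⟩
      0#                                          ∎
      where
      aᵏw = map (a ^ᴿ k *_) w
      deg-aᵏw : Deg aᵏw i
      deg-aᵏw j i<j = trans (coeff-scale _ w j) (above j i<j)
      1ₚ-vanishes : coeff 1ₚ (i N.+ suc n) ≈ 0#
      1ₚ-vanishes = P.subst (λ t → coeff 1ₚ t ≈ 0#) (P.sym (NP.+-suc i n)) refl
    annihilates : ∀ k i → M N.< i N.+ k → a ^ᴿ k * coeff w i ≈ 0#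
    annihilates zero i M<i+0 = trans (*-identityˡ _)
      (coeff-beyond w i (NP.<⇒≤ (P.subst (M N.<_) (NP.+-identityʳ i) M<i+0)))
    annihilates (suc k) i M<i+1+k with NP.m≤n⇒m<n∨m≡n (NP.≤-pred (P.subst (M N.<_) (NP.+-suc i k) M<i+1+k))
    ... | inj₁ M<i+k = trans (*-assoc _ _ _) (trans (*-cong refl (annihilates k i M<i+k)) (zeroʳ _))
    ... | inj₂ M≡i+k = step k i (λ j i<j → annihilates k j (P.subst (N._< j N.+ k) (P.sym M≡i+k) (NP.+-monoˡ-< k i<j)))

  units-are-constant : Reduced → ∀ w g → w *ₚ g ≈ₚ 1ₚ → Deg g 0
  units-are-constant red w g wg≈1 = lower (length g) (λ i h → coeff-beyond g i (NP.<⇒≤ h))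
    where
    lower : ∀ n → Deg g n → Deg g 0
    lower zero deg = deg
    lower (suc n) deg = lower n deg′
      where
      deg′ : Deg g n
      deg′ i n<i with NP.m≤n⇒m<n∨m≡n n<i
      ... | inj₁ 1+n<i = deg i 1+n<i
      ... | inj₂ P.refl = red (coeff g (suc n)) (suc (length w)) (leading-coefficient-nilpotent w g n wg≈1 deg)

  -- Peeling powers of x off f = xᵏ·g: while the cofactor g (a divisor of f)
  -- is not a unit it is a multiple of x, so f = xᵏ⁺¹·(tl g).  After n steps,
  -- with length f ≤ k + n, either f has no nonzero coefficient left or we
  -- reached f = xᵏ′·u with u a unit.
  peel : ∀ {f} → (∀ d → d ∣ₚ f → IsUnit d ⊎ X ∣ₚ d) →
         ∀ n k g → Shift k g f → length f N.≤ k N.+ n →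
         (f ≈ₚ []) ⊎ Σ ℕ λ k′ → Σ Pol λ u → k N.≤ k′ × Shift k′ u f × IsUnit u
  peel {f} divisors zero k g sh bound = inj₁ vanishes
    where
    vanishes : f ≈ₚ []
    vanishes t with t N.<? k
    ... | yes t<k = low sh t t<k
    ... | no t≮k = coeff-beyond f t (NP.≤-trans bound
                     (P.subst (N._≤ t) (P.sym (NP.+-identityʳ k)) (NP.≮⇒≥ t≮k)))
  peel {f} divisors (suc n) k g sh bound with divisors g (shift⇒∣ sh)
  ... | inj₁ g-unit = inj₂ (k , g , NP.≤-refl , sh , g-unit)
  ... | inj₂ X∣g with peel divisors n (k N.+ 1) (tl g) (shift-trans sh (shift-tail g (X∣⇒const≈0 g X∣g)))
                        (P.subst (length f N.≤_) (P.sym (NP.+-assoc k 1 n)) bound)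
  ...   | inj₁ f≈0 = inj₁ f≈0
  ...   | inj₂ (k′ , u , k+1≤k′ , sh′ , u-unit) = inj₂ (k′ , u , NP.≤-trans (NP.m≤m+n k 1) k+1≤k′ , sh′ , u-unit)

  lpow⊆pow : NonzeroRing → Reduced → ∀ f → lpow X f → pow X f
  lpow⊆pow nonzero red f (X∣f , X-1∣f-1 , divisors)
    with peel divisors (length f) 1 (tl f) (shift-tail f (X∣⇒const≈0 f X∣f)) (NP.n≤1+n (length f))
  ... | inj₁ f≈0 = ⊥-elim (nonzero (trans (sym (ev≈1 f X-1∣f-1)) (ev-cong f [] f≈0)))
  ... | inj₂ (k , u , 1≤k , f≈xᵏu , (w , wu≈1)) = k , 1≤k , shift-unique f≈xᵏu (shift-X^ k) u≈1
    where
    -- u is a constant with u(1) = f(1) = 1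
    u-constant : Deg u 0
    u-constant = units-are-constant red w u wu≈1
    u≈1 : u ≈ₚ 1ₚ
    u≈1 zero = trans (sym (ev-constant u u-constant)) (trans (sym (ev-shift f≈xᵏu)) (ev≈1 f X-1∣f-1))
    u≈1 (suc i) = u-constant (suc i) (s≤s z≤n)

  -- with G = 1 + x + ⋯ + xᵐ, the coefficient of xˢ⁺¹ in G·(x - 1),
  -- namely -Gₛ₊₁ + Gₛ, equals the coefficient of xˢ in xᵐ
  geometric-coeff : ∀ m s → coeff (replicate (suc m) 1#) (suc s) * (0# + - 1#) + coeff (replicate (suc m) 1#) s
                            ≈ coeff (X ^ₚ m) s
  geometric-coeff zero s = trans (+-cong (zeroˡ _) refl) (+-identityˡ _)
  geometric-coeff (suc m) zero = begin
    1# * (0# + - 1#) + 1#    ≈⟨ +-cong (trans (*-identityˡ _) (+-identityˡ _)) refl ⟩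
    - 1# + 1#                ≈⟨ -‿inverseˡ 1# ⟩
    0#                       ≈⟨ sym (low (X*-shift (X ^ₚ m)) 0 (s≤s z≤n)) ⟩
    coeff (X ^ₚ suc m) 0     ∎
  geometric-coeff (suc m) (suc s) = trans (geometric-coeff m s) (sym (high (X*-shift (X ^ₚ m)) s))

  geometric-sum : ∀ m → replicate (suc m) 1# *ₚ (X -ₚ 1ₚ) ≈ₚ X ^ₚ suc m -ₚ 1ₚ
  geometric-sum m zero = begin
    coeff (G *ₚ (X -ₚ 1ₚ)) 0           ≈⟨ trans (coeff-*-zero G (X -ₚ 1ₚ)) (*-identityˡ _) ⟩
    0# + - 1#                          ≈⟨ +-cong (sym (low (shift-X^ (suc m)) 0 (s≤s z≤n))) refl ⟩
    coeff (X ^ₚ suc m) 0 + - 1#        ≈⟨ sym (coeff-+ (X ^ₚ suc m) (-ₚ 1ₚ) 0) ⟩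
    coeff (X ^ₚ suc m -ₚ 1ₚ) 0         ∎
    where G = replicate (suc m) 1#
  geometric-sum m (suc s) = begin
    coeff (G *ₚ (X -ₚ 1ₚ)) (suc s)                       ≈⟨ coeff-*-sucʳ G (X -ₚ 1ₚ) s ⟩
    coeff G (suc s) * (0# + - 1#) + coeff (G *ₚ 1ₚ) s    ≈⟨ +-cong refl (coeff-*-1ₚ G s) ⟩
    coeff G (suc s) * (0# + - 1#) + coeff G s            ≈⟨ geometric-coeff m s ⟩
    coeff (X ^ₚ m) s                                     ≈⟨ sym (high (X*-shift (X ^ₚ m)) s) ⟩
    coeff (X ^ₚ suc m) (suc s)                           ≈⟨ sym (+-identityʳ _) ⟩
    coeff (X ^ₚ suc m) (suc s) + 0#                      ≈⟨ sym (coeff-+ (X ^ₚ suc m) (-ₚ 1ₚ) (suc s)) ⟩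
    coeff (X ^ₚ suc m -ₚ 1ₚ) (suc s)                     ∎
    where G = replicate (suc m) 1#

  annihilates-product : ∀ a p r s → (∀ i → i N.≤ s → a * coeff p i ≈ 0#) → a * coeff (p *ₚ r) s ≈ 0#
  annihilates-product a p r s ann = trans (sym (coeff-scale-* a p r s))
    (coeff-*-low (map (a *_) p) r s (λ i i≤s → trans (coeff-scale a p i) (ann i i≤s)))

  module FactorOfXPower (red : Reduced) (m : ℕ) (q d : Pol) (qd≈xᵐ⁺¹ : q *ₚ d ≈ₚ X ^ₚ suc m) where
    d₀ = coeff d 0

    -- d₀·qₛ = 0 once d₀ annihilates q₀, …, qₛ₋₁ (s ≤ m): for s > 0 comparing
    -- coefficients of xˢ gives qₛ·d₀ + z = 0 with d₀·z = 0, so (d₀·qₛ)² = 0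
    annihilates-next : ∀ s → s N.≤ m → (∀ i → i N.< s → d₀ * coeff q i ≈ 0#) → d₀ * coeff q s ≈ 0#
    annihilates-next zero _ _ = begin
      d₀ * coeff q 0          ≈⟨ *-comm _ _ ⟩
      coeff q 0 * d₀          ≈⟨ sym (coeff-*-zero q d) ⟩
      coeff (q *ₚ d) 0        ≈⟨ qd≈xᵐ⁺¹ 0 ⟩
      coeff (X ^ₚ suc m) 0    ≈⟨ low (shift-X^ (suc m)) 0 (s≤s z≤n) ⟩
      0#                      ∎
    annihilates-next (suc s) s<m below = red y 2 y²≈0
      where
      u = coeff q (suc s)
      z = coeff (q *ₚ tl d) s
      y = d₀ * u
      ud₀+z≈0 : u * d₀ + z ≈ 0#
      ud₀+z≈0 = trans (sym (coeff-*-sucʳ q d s)) (trans (qd≈xᵐ⁺¹ (suc s)) (low (shift-X^ (suc m)) (suc s) (s≤s s<m)))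
      d₀z≈0 : d₀ * z ≈ 0#
      d₀z≈0 = annihilates-product d₀ q (tl d) s (λ i i≤s → below i (s≤s i≤s))
      y²≈0 : y ^ᴿ 2 ≈ 0#
      y²≈0 = begin
        y * (y * 1#)             ≈⟨ *-cong refl (*-identityʳ y) ⟩
        y * y                    ≈⟨ sym (+-identityʳ _) ⟩
        y * y + 0#               ≈⟨ +-cong (*-cong refl (*-comm d₀ u)) (sym (trans (*-cong refl d₀z≈0) (zeroʳ u))) ⟩
        y * (u * d₀) + u * (d₀ * z) ≈⟨ +-cong refl (sym (*-Props.xy∙z≈y∙xz d₀ u z)) ⟩
        y * (u * d₀) + y * z     ≈⟨ sym (distribˡ y (u * d₀) z) ⟩
        y * (u * d₀ + z)         ≈⟨ *-cong refl ud₀+z≈0 ⟩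
        y * 0#                   ≈⟨ zeroʳ y ⟩
        0#                       ∎

    annihilated : ∀ s → s N.≤ suc m → ∀ i → i N.< s → d₀ * coeff q i ≈ 0#
    annihilated zero _ i ()
    annihilated (suc s) (s≤s s≤m) i (s≤s i≤s) with NP.m≤n⇒m<n∨m≡n i≤s
    ... | inj₁ i<s = annihilated s (NP.m≤n⇒m≤1+n s≤m) i i<s
    ... | inj₂ P.refl = annihilates-next s s≤m (annihilated s (NP.m≤n⇒m≤1+n s≤m))

    annihilated-low : ∀ i → i N.< suc m → d₀ * coeff q i ≈ 0#
    annihilated-low = annihilated (suc m) NP.≤-refl

    qₘ₊₁ = coeff q (suc m)
    e = d₀ * qₘ₊₁

    -- from the coefficient of xᵐ⁺¹: d₀ = d₀·(qₘ₊₁·d₀ + z) = e·d₀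
    d₀≈ed₀ : d₀ ≈ e * d₀
    d₀≈ed₀ = begin
      d₀                                       ≈⟨ sym (*-identityʳ _) ⟩
      d₀ * 1#                                  ≈⟨ *-cong refl (sym top) ⟩
      d₀ * (qₘ₊₁ * d₀ + z)                     ≈⟨ distribˡ _ _ _ ⟩
      d₀ * (qₘ₊₁ * d₀) + d₀ * z                ≈⟨ +-cong (sym (*-assoc _ _ _)) d₀z≈0 ⟩
      e * d₀ + 0#                              ≈⟨ +-identityʳ _ ⟩
      e * d₀                                   ∎
      where
      z = coeff (q *ₚ tl d) m
      top : qₘ₊₁ * d₀ + z ≈ 1#
      top = trans (sym (coeff-*-sucʳ q d m)) (trans (qd≈xᵐ⁺¹ (suc m)) (shift-head (shift-X^ (suc m))))
      d₀z≈0 : d₀ * z ≈ 0#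
      d₀z≈0 = annihilates-product d₀ q (tl d) m (λ i i≤m → annihilated-low i (s≤s i≤m))

    e-idempotent : e * e ≈ e
    e-idempotent = trans (sym (*-assoc e d₀ qₘ₊₁)) (*-cong (sym d₀≈ed₀) refl)

    e≈0⇒X∣d : e ≈ 0# → X ∣ₚ d
    e≈0⇒X∣d e≈0 = const≈0⇒X∣ d (trans d₀≈ed₀ (trans (*-cong e≈0 refl) (zeroˡ _)))

    -- e = 1 forces q₀ = ⋯ = qₘ = 0, so q = xᵐ⁺¹·q′ and q′·d = 1
    e≈1⇒unit : e ≈ 1# → IsUnit d
    e≈1⇒unit e≈1 = drop (suc m) q , shift-cancel (shift-drop-* (suc m) q d q-low) (shift-X^ (suc m)) qd≈xᵐ⁺¹
      where
      q-low : ∀ i → i N.< suc m → coeff q i ≈ 0#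
      q-low i i≤m = begin
        coeff q i                 ≈⟨ sym (*-identityˡ _) ⟩
        1# * coeff q i            ≈⟨ *-cong (sym e≈1) refl ⟩
        e * coeff q i             ≈⟨ *-Props.xy∙z≈y∙xz d₀ qₘ₊₁ (coeff q i) ⟩
        qₘ₊₁ * (d₀ * coeff q i)   ≈⟨ *-cong refl (annihilated-low i i≤m) ⟩
        qₘ₊₁ * 0#                 ≈⟨ zeroʳ _ ⟩
        0#                        ∎

  divisor-of-X-power : Reduced → Indecomposable → ∀ m q d → q *ₚ d ≈ₚ X ^ₚ suc m → IsUnit d ⊎ X ∣ₚ d
  divisor-of-X-power red indec m q d qd≈xᵐ⁺¹ = decide (indec e e-idempotent)
    where
    open FactorOfXPower red m q d qd≈xᵐ⁺¹
    decide : (e ≈ 0#) ⊎ (e ≈ 1#) → IsUnit d ⊎ X ∣ₚ d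
    decide (inj₁ e≈0) = inj₂ (e≈0⇒X∣d e≈0)
    decide (inj₂ e≈1) = inj₁ (e≈1⇒unit e≈1)

  pow⊆lpow : Reduced → Indecomposable → ∀ f → pow X f → lpow X f
  pow⊆lpow red indec f (zero , () , _)
  pow⊆lpow red indec f (suc m , _ , f≈xᵐ⁺¹) = X∣f , X-1∣f-1 , divisors
    where
    X∣f : X ∣ₚ f
    X∣f = const≈0⇒X∣ f (trans (f≈xᵐ⁺¹ 0) (low (shift-X^ (suc m)) 0 (s≤s z≤n)))
    f-1≈xᵐ⁺¹-1 : X ^ₚ suc m -ₚ 1ₚ ≈ₚ f -ₚ 1ₚ
    f-1≈xᵐ⁺¹-1 t = trans (coeff-+ (X ^ₚ suc m) (-ₚ 1ₚ) t)
                         (trans (+-cong (sym (f≈xᵐ⁺¹ t)) refl) (sym (coeff-+ f (-ₚ 1ₚ) t)))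
    X-1∣f-1 : (X -ₚ 1ₚ) ∣ₚ (f -ₚ 1ₚ)
    X-1∣f-1 = replicate (suc m) 1# , λ t → trans (geometric-sum m t) (f-1≈xᵐ⁺¹-1 t)
    divisors : ∀ d → d ∣ₚ f → IsUnit d ⊎ X ∣ₚ d
    divisors d (q , qd≈f) = divisor-of-X-power red indec m q d (λ t → trans (qd≈f t) (f≈xᵐ⁺¹ t))

theorem4p4 : ∀ {c ℓ} (R : CommutativeRing c ℓ) → let open Poly R in
    NonzeroRing →
    (Reduced → ∀ (f : Pol) → lpow X f → pow X f) ×
    (Reduced → Indecomposable →
      (∀ (f : Pol) → lpow X f → pow X f) × (∀ (f : Pol) → pow X f → lpow X f))
theorem4p4 R nonzero =
  (λ red → lpow⊆pow nonzero red) ,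
  (λ red indec → lpow⊆pow nonzero red , pow⊆lpow red indec)
  where open XPowers R
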